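{- The split-star network $S_4^2$ is 2-DCC vertex $[3,12]$-pancyclic: for any two distinct vertices $u,v$ of $S_4^2$ and any integer $\ell$ with $3 \le \ell \le 12$, there exist two vertex-disjoint cycles $C_1, C_2$ in $S_4^2$ with $u \in V(C_1)$, $v \in V(C_2)$, and either ($|C_1| = \ell$, $|C_2| = 24-\ell$) or ($|C_1| = 24-\ell$, $|C_2| = \ell$).
   Context: For $n \geq 3$, the split-star network $S_n^2$ is the graph whose vertex set is the set of all permutations of $[n]$, written as strings $x_1x_2\cdots x_n$. Two distinct vertices $u = x_1\cdots x_n$ and $v = y_1\cdots y_n$ are adjacent iff one of the following holds: (i) $y_1 = x_2$, $y_2 = x_1$, $y_j = x_j$ for all $j \in [3,n]$; (ii) for some $i \in [3,n]$: $y_1 = x_2$, $y_2 = x_i$, $y_i = x_1$, $y_j = x_j$ for $j \in [3,n]\setminus\{i\}$; (iii) for some $i \in [3,n]$: $y_1 = x_i$, $y_2 = x_1$, $y_i = x_2$, $y_j = x_j$ for $j \in [3,n]\setminus\{i\}$. The length of a cycle is its number of edges. -}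

module Defs where

open import Data.Nat using (ℕ; _≤_; _+_)
open import Data.Fin using (Fin; toℕ; zero; suc)
open import Data.Vec using (Vec; lookup)
open import Data.List using (List; []; _∷_; _++_; [_]; length)
open import Data.List.Relation.Unary.All using (All)
open import Data.List.Relation.Unary.Linked using (Linked)
open import Data.List.Relation.Unary.Unique.Propositional using (Unique)
open import Data.Product using (Σ; _×_)
open import Data.Sum using (_⊎_)
open import Relation.Binary.PropositionalEquality using (_≡_; _≢_)
open import Relation.Nullary using (¬_)
open import Data.Empty using (⊥)

-- A string x₁…xₙ over the alphabet Fin n (= [n] shifted to 0-based);
-- position p (1-based in the paper) is index p-1 here.
Word : ℕ → Set
Word n = Vec (Fin n) n

IsPerm : {n : ℕ} → Word n → Set
IsPerm {n} x = (i j : Fin n) → lookup x i ≡ lookup x j → i ≡ j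

Tail : {n : ℕ} → Fin n → Set
Tail i = 2 ≤ toℕ i

-- the edge rules (i), (ii), (iii) of the split-star network S_n^2
-- (positions 1,2 are indices 0,1; requires n ≥ 2 for them to exist)
module _ {n : ℕ} where
  Rule1 : Word (2 + n) → Word (2 + n) → Set
  Rule1 x y = lookup y zero ≡ lookup x (suc zero)
            × lookup y (suc zero) ≡ lookup x zero
            × ((j : Fin (2 + n)) → Tail j → lookup y j ≡ lookup x j)

  Rule2 : Word (2 + n) → Word (2 + n) → Fin (2 + n) → Set
  Rule2 x y i = lookup y zero ≡ lookup x (suc zero)
              × lookup y (suc zero) ≡ lookup x i
              × lookup y i ≡ lookup x zero
              × ((j : Fin (2 + n)) → Tail j → j ≢ i → lookup y j ≡ lookup x j)

  Rule3 : Word (2 + n) → Word (2 + n) → Fin (2 + n) → Set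
  Rule3 x y i = lookup y zero ≡ lookup x i
              × lookup y (suc zero) ≡ lookup x zero
              × lookup y i ≡ lookup x (suc zero)
              × ((j : Fin (2 + n)) → Tail j → j ≢ i → lookup y j ≡ lookup x j)

  Adj : Word (2 + n) → Word (2 + n) → Set
  Adj x y = x ≢ y
          × (Rule1 x y
             ⊎ Σ (Fin (2 + n)) (λ i → Tail i × Rule2 x y i)
             ⊎ Σ (Fin (2 + n)) (λ i → Tail i × Rule3 x y i))

-- Its length (number of edges) equals the number of vertices, length c.
IsCycle : {n : ℕ} → List (Word (2 + n)) → Set
IsCycle [] = ⊥
IsCycle {n} (v ∷ vs) =
  3 ≤ length (v ∷ vs)
  × Unique (v ∷ vs)
  × All IsPerm (v ∷ vs)
  × Linked (Adj {n}) ((v ∷ vs) ++ [ v ])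

Disjoint : {A : Set} → List A → List A → Set
Disjoint {A} c₁ c₂ = (w : A) → w ∈ c₁ → ¬ (w ∈ c₂)
  where open import Data.List.Membership.Propositional using (_∈_)

{-# OPTIONS --safe #-}
-- For each ℓ we exhibit a few pairs of vertex-disjoint
-- cycles of lengths ℓ and 24 − ℓ (so each pair covers all 24 vertices of S₄²) such
-- that any two distinct vertices lie on different cycles of at least one pair. All
-- the defining properties are decidable, so the certificates are checked by evaluation.
module Submission where

open import Defs
open import Data.Nat using (ℕ; suc; NonZero; _≤_; _<_; _+_; _∸_; _≤?_; s≤s) renaming (_≟_ to _≟ℕ_)
open import Data.Nat.Properties using (m+[n∸m]≡n; m<n+o⇒m∸n<o)
open import Data.Fin using (Fin; zero; suc; toℕ; _≟_; #_)
open import Data.Fin.Properties using (all?; any?)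
open import Data.Vec using (Vec; []; _∷_; lookup)
open import Data.Vec.Properties using (≡-dec)
open import Data.List
  using (List; []; _∷_; _++_; [_]; length; filter; cartesianProductWith; allFin; applyUpTo)
open import Data.List.Membership.Propositional using (_∈_)
open import Data.List.Membership.Propositional.Properties
  using (∈-cartesianProductWith⁺; ∈-allFin; ∈-filter⁺; ∈-applyUpTo⁺)
open import Data.List.Relation.Unary.All as All using (All)
open import Data.List.Relation.Unary.Any as Any using (Any)
open import Data.List.Relation.Unary.Linked using (linked?)
import Data.List.Membership.DecPropositional as DecMembership
import Data.List.Relation.Unary.Unique.DecPropositional as DecUnique
open import Data.Product using (Σ; _×_; _,_)
open import Data.Sum using (_⊎_; inj₁; inj₂)
open import Relation.Binary.Definitions using (DecidableEquality)
open import Relation.Binary.PropositionalEquality using (_≡_; _≢_; refl; subst)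
open import Relation.Nullary using (Dec; no; ¬?)
open import Relation.Nullary.Decidable using (_×-dec_; _⊎-dec_; _→-dec_; map′; from-yes)

_≟ʷ_ : {n : ℕ} → DecidableEquality (Word n)
_≟ʷ_ = ≡-dec _≟_

isPerm? : {n : ℕ} (x : Word n) → Dec (IsPerm x)
isPerm? x = all? λ i → all? λ j → (lookup x i ≟ lookup x j) →-dec (i ≟ j)

tail? : {n : ℕ} (i : Fin n) → Dec (Tail i)
tail? i = 2 ≤? toℕ i

module _ {n : ℕ} (x y : Word (2 + n)) where

  private
    agreesElsewhere? : (i : Fin (2 + n)) →
      Dec ((j : Fin (2 + n)) → Tail j → j ≢ i → lookup y j ≡ lookup x j)
    agreesElsewhere? i = all? λ j → tail? j →-dec (¬? (j ≟ i) →-dec (lookup y j ≟ lookup x j))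

  rule1? : Dec (Rule1 x y)
  rule1? = (lookup y zero ≟ lookup x (suc zero)) ×-dec (lookup y (suc zero) ≟ lookup x zero)
    ×-dec all? (λ j → tail? j →-dec (lookup y j ≟ lookup x j))

  rule2? : (i : Fin (2 + n)) → Dec (Rule2 x y i)
  rule2? i = (lookup y zero ≟ lookup x (suc zero)) ×-dec (lookup y (suc zero) ≟ lookup x i)
    ×-dec (lookup y i ≟ lookup x zero) ×-dec agreesElsewhere? i

  rule3? : (i : Fin (2 + n)) → Dec (Rule3 x y i)
  rule3? i = (lookup y zero ≟ lookup x i) ×-dec (lookup y (suc zero) ≟ lookup x zero)
    ×-dec (lookup y i ≟ lookup x (suc zero)) ×-dec agreesElsewhere? i

  adj? : Dec (Adj x y)
  adj? = ¬? (x ≟ʷ y) ×-dec (rule1?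
    ⊎-dec any? (λ i → tail? i ×-dec rule2? i)
    ⊎-dec any? (λ i → tail? i ×-dec rule3? i))

isCycle? : {n : ℕ} (C : List (Word (2 + n))) → Dec (IsCycle C)
isCycle? []       = no λ ()
isCycle? (v ∷ vs) = (3 ≤? length (v ∷ vs)) ×-dec DecUnique.unique? _≟ʷ_ (v ∷ vs)
  ×-dec All.all? isPerm? (v ∷ vs) ×-dec linked? adj? ((v ∷ vs) ++ [ v ])

disjoint? : {A : Set} → DecidableEquality A → (C₁ C₂ : List A) → Dec (Disjoint C₁ C₂)
disjoint? _≟ᴬ_ C₁ C₂ = map′ (λ C₁∉C₂ _ → All.lookup C₁∉C₂) (λ d → All.tabulate (d _))
  (All.all? (λ w → ¬? (w ∈? C₂)) C₁)
  where open DecMembership _≟ᴬ_ using (_∈?_)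

vectors : (k n : ℕ) → List (Vec (Fin k) n)
vectors k 0       = [ [] ]
vectors k (suc n) = cartesianProductWith _∷_ (allFin k) (vectors k n)

∈-vectors : {k n : ℕ} (x : Vec (Fin k) n) → x ∈ vectors k n
∈-vectors []      = Any.here refl
∈-vectors (a ∷ x) = ∈-cartesianProductWith⁺ _∷_ (∈-allFin a) (∈-vectors x)

permutations : (n : ℕ) → List (Word n)
permutations n = filter isPerm? (vectors n n)

∈-permutations : {n : ℕ} {x : Word n} → IsPerm x → x ∈ permutations n
∈-permutations {x = x} = ∈-filter⁺ isPerm? (∈-vectors x)

module _ {n : ℕ} where

  CyclePair : Set
  CyclePair = List (Word (2 + n)) × List (Word (2 + n))

  IsCyclePair : ℕ → ℕ → CyclePair → Set
  IsCyclePair ℓ m (C₁ , C₂) =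
    IsCycle C₁ × IsCycle C₂ × Disjoint C₁ C₂ × length C₁ ≡ ℓ × length C₂ ≡ m

  Separates : Word (2 + n) → Word (2 + n) → CyclePair → Set
  Separates u v (C₁ , C₂) = (u ∈ C₁ × v ∈ C₂) ⊎ (v ∈ C₁ × u ∈ C₂)

  SeparatesPermutations : List CyclePair → Set
  SeparatesPermutations F =
    All (λ u → All (λ v → u ≢ v → Any (Separates u v) F) (permutations (2 + n))) (permutations (2 + n))

  Certificate : ℕ → ℕ → List CyclePair → Set
  Certificate ℓ m F = All (IsCyclePair ℓ m) F × SeparatesPermutations F

  certificate? : (ℓ m : ℕ) (F : List CyclePair) → Dec (Certificate ℓ m F)
  certificate? ℓ m F = All.all? isCyclePair? F ×-dec All.all? (λ u → All.all? (λ v →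
      ¬? (u ≟ʷ v) →-dec Any.any? (separates? u v) F) (permutations (2 + n))) (permutations (2 + n))
    where
    open DecMembership (_≟ʷ_ {2 + n}) using (_∈?_)

    isCyclePair? : (P : CyclePair) → Dec (IsCyclePair ℓ m P)
    isCyclePair? (C₁ , C₂) = isCycle? C₁ ×-dec isCycle? C₂ ×-dec disjoint? _≟ʷ_ C₁ C₂
      ×-dec (length C₁ ≟ℕ ℓ) ×-dec (length C₂ ≟ℕ m)

    separates? : (u v : Word (2 + n)) (P : CyclePair) → Dec (Separates u v P)
    separates? u v (C₁ , C₂) = ((u ∈? C₁) ×-dec (v ∈? C₂)) ⊎-dec ((v ∈? C₁) ×-dec (u ∈? C₂))

  SeparatingCycles : Word (2 + n) → Word (2 + n) → ℕ → ℕ → Set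
  SeparatingCycles u v ℓ m = Σ (List (Word (2 + n))) λ C₁ → Σ (List (Word (2 + n))) λ C₂ →
    IsCycle C₁ × IsCycle C₂ × Disjoint C₁ C₂ × u ∈ C₁ × v ∈ C₂
    × ((length C₁ ≡ ℓ × length C₂ ≡ m) ⊎ (length C₁ ≡ m × length C₂ ≡ ℓ))

  separatingCycles : {u v : Word (2 + n)} {ℓ m : ℕ} (P : CyclePair) →
    IsCyclePair ℓ m P → Separates u v P → SeparatingCycles u v ℓ m
  separatingCycles (C₁ , C₂) (c₁ , c₂ , d , l₁ , l₂) (inj₁ (u∈C₁ , v∈C₂)) =
    C₁ , C₂ , c₁ , c₂ , d , u∈C₁ , v∈C₂ , inj₁ (l₁ , l₂)
  separatingCycles (C₁ , C₂) (c₁ , c₂ , d , l₁ , l₂) (inj₂ (v∈C₁ , u∈C₂)) =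
    C₂ , C₁ , c₂ , c₁ , (λ w w∈C₂ w∈C₁ → d w w∈C₁ w∈C₂) , u∈C₂ , v∈C₁ , inj₂ (l₂ , l₁)

  certificate⇒separatingCycles : {ℓ m : ℕ} {F : List CyclePair} → Certificate ℓ m F →
    {u v : Word (2 + n)} → IsPerm u → IsPerm v → u ≢ v → SeparatingCycles u v ℓ m
  certificate⇒separatingCycles (pairs , separated) pu pv u≢v =
    let isPair , separates = All.lookupAny pairs
          (All.lookup (All.lookup separated (∈-permutations pu)) (∈-permutations pv) u≢v)
    in separatingCycles _ isPair separates

∈-applyUpTo-+ : {m k ℓ : ℕ} .{{_ : NonZero k}} → m ≤ ℓ → ℓ < m + k → ℓ ∈ applyUpTo (m +_) k
∈-applyUpTo-+ {m} {k} {ℓ} m≤ℓ ℓ<m+k =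
  subst (_∈ applyUpTo (m +_) k) (m+[n∸m]≡n m≤ℓ) (∈-applyUpTo⁺ (m +_) (m<n+o⇒m∸n<o ℓ m ℓ<m+k))

p0123 p0132 p0213 p0231 p0312 p0321 : Word 4
p0123 = # 0 ∷ # 1 ∷ # 2 ∷ # 3 ∷ []
p0132 = # 0 ∷ # 1 ∷ # 3 ∷ # 2 ∷ []
p0213 = # 0 ∷ # 2 ∷ # 1 ∷ # 3 ∷ []
p0231 = # 0 ∷ # 2 ∷ # 3 ∷ # 1 ∷ []
p0312 = # 0 ∷ # 3 ∷ # 1 ∷ # 2 ∷ []
p0321 = # 0 ∷ # 3 ∷ # 2 ∷ # 1 ∷ []

p1023 p1032 p1203 p1230 p1302 p1320 : Word 4
p1023 = # 1 ∷ # 0 ∷ # 2 ∷ # 3 ∷ []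
p1032 = # 1 ∷ # 0 ∷ # 3 ∷ # 2 ∷ []
p1203 = # 1 ∷ # 2 ∷ # 0 ∷ # 3 ∷ []
p1230 = # 1 ∷ # 2 ∷ # 3 ∷ # 0 ∷ []
p1302 = # 1 ∷ # 3 ∷ # 0 ∷ # 2 ∷ []
p1320 = # 1 ∷ # 3 ∷ # 2 ∷ # 0 ∷ []

p2013 p2031 p2103 p2130 p2301 p2310 : Word 4
p2013 = # 2 ∷ # 0 ∷ # 1 ∷ # 3 ∷ []
p2031 = # 2 ∷ # 0 ∷ # 3 ∷ # 1 ∷ []
p2103 = # 2 ∷ # 1 ∷ # 0 ∷ # 3 ∷ []
p2130 = # 2 ∷ # 1 ∷ # 3 ∷ # 0 ∷ []
p2301 = # 2 ∷ # 3 ∷ # 0 ∷ # 1 ∷ []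
p2310 = # 2 ∷ # 3 ∷ # 1 ∷ # 0 ∷ []

p3012 p3021 p3102 p3120 p3201 p3210 : Word 4
p3012 = # 3 ∷ # 0 ∷ # 1 ∷ # 2 ∷ []
p3021 = # 3 ∷ # 0 ∷ # 2 ∷ # 1 ∷ []
p3102 = # 3 ∷ # 1 ∷ # 0 ∷ # 2 ∷ []
p3120 = # 3 ∷ # 1 ∷ # 2 ∷ # 0 ∷ []
p3201 = # 3 ∷ # 2 ∷ # 0 ∷ # 1 ∷ []
p3210 = # 3 ∷ # 2 ∷ # 1 ∷ # 0 ∷ []

family : ℕ → List (CyclePair {2})
family 3 =
    (p0312 ∷ p1032 ∷ p3102 ∷ []
    , p3210 ∷ p2310 ∷ p1230 ∷ p3120 ∷ p1023 ∷ p0123 ∷ p1320 ∷ p2130 ∷ p0231 ∷ p2301 ∷ p3021 ∷ p0321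
      ∷ p2031 ∷ p3201 ∷ p1302 ∷ p0132 ∷ p3012 ∷ p0213 ∷ p2103 ∷ p1203 ∷ p2013 ∷ [])
  ∷ (p0213 ∷ p1023 ∷ p2103 ∷ []
    , p2310 ∷ p3210 ∷ p1320 ∷ p2130 ∷ p1032 ∷ p0132 ∷ p1230 ∷ p3120 ∷ p0321 ∷ p3201 ∷ p2031 ∷ p0231
      ∷ p3021 ∷ p2301 ∷ p1203 ∷ p0123 ∷ p2013 ∷ p0312 ∷ p3102 ∷ p1302 ∷ p3012 ∷ [])
  ∷ (p0321 ∷ p2031 ∷ p3201 ∷ []
    , p3120 ∷ p1320 ∷ p2130 ∷ p3210 ∷ p2013 ∷ p0213 ∷ p2310 ∷ p1230 ∷ p0132 ∷ p1302 ∷ p3012 ∷ p0312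
      ∷ p1032 ∷ p3102 ∷ p2301 ∷ p0231 ∷ p3021 ∷ p0123 ∷ p1203 ∷ p2103 ∷ p1023 ∷ [])
  ∷ (p0123 ∷ p2013 ∷ p1203 ∷ []
    , p1320 ∷ p3120 ∷ p2310 ∷ p1230 ∷ p2031 ∷ p0231 ∷ p2130 ∷ p3210 ∷ p0312 ∷ p3102 ∷ p1032 ∷ p0132
      ∷ p3012 ∷ p1302 ∷ p2103 ∷ p0213 ∷ p1023 ∷ p0321 ∷ p3201 ∷ p2301 ∷ p3021 ∷ [])
  ∷ (p0231 ∷ p3021 ∷ p2301 ∷ []
    , p2130 ∷ p1230 ∷ p3120 ∷ p2310 ∷ p3012 ∷ p0312 ∷ p3210 ∷ p1320 ∷ p0123 ∷ p1203 ∷ p2013 ∷ p0213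
      ∷ p1023 ∷ p2103 ∷ p3201 ∷ p0321 ∷ p2031 ∷ p0132 ∷ p1302 ∷ p3102 ∷ p1032 ∷ [])
  ∷ (p0132 ∷ p3012 ∷ p1302 ∷ []
    , p1230 ∷ p2130 ∷ p3210 ∷ p1320 ∷ p3021 ∷ p0321 ∷ p3120 ∷ p2310 ∷ p0213 ∷ p2103 ∷ p1023 ∷ p0123
      ∷ p2013 ∷ p1203 ∷ p3102 ∷ p0312 ∷ p1032 ∷ p0231 ∷ p2301 ∷ p3201 ∷ p2031 ∷ [])
  ∷ (p1320 ∷ p2130 ∷ p3210 ∷ []
    , p3021 ∷ p0321 ∷ p2031 ∷ p3201 ∷ p2103 ∷ p1203 ∷ p2301 ∷ p0231 ∷ p1032 ∷ p0312 ∷ p3102 ∷ p1302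
      ∷ p0132 ∷ p3012 ∷ p2310 ∷ p1230 ∷ p3120 ∷ p1023 ∷ p0213 ∷ p2013 ∷ p0123 ∷ [])
  ∷ (p1032 ∷ p2130 ∷ p0231 ∷ []
    , p1230 ∷ p2031 ∷ p3201 ∷ p2301 ∷ p3021 ∷ p0321 ∷ p1023 ∷ p2103 ∷ p1203 ∷ p0123 ∷ p1320 ∷ p3120
      ∷ p2310 ∷ p3210 ∷ p2013 ∷ p0213 ∷ p3012 ∷ p0312 ∷ p3102 ∷ p1302 ∷ p0132 ∷ [])
  ∷ (p1023 ∷ p3120 ∷ p0321 ∷ []
    , p1320 ∷ p3021 ∷ p2301 ∷ p3201 ∷ p2031 ∷ p0231 ∷ p1032 ∷ p3102 ∷ p1302 ∷ p0132 ∷ p1230 ∷ p2130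
      ∷ p3210 ∷ p2310 ∷ p3012 ∷ p0312 ∷ p2013 ∷ p0213 ∷ p2103 ∷ p1203 ∷ p0123 ∷ [])
  ∷ (p2031 ∷ p1230 ∷ p0132 ∷ []
    , p2130 ∷ p1032 ∷ p3102 ∷ p1302 ∷ p3012 ∷ p0312 ∷ p2013 ∷ p1203 ∷ p2103 ∷ p0213 ∷ p2310 ∷ p3210
      ∷ p1320 ∷ p3120 ∷ p1023 ∷ p0123 ∷ p3021 ∷ p0321 ∷ p3201 ∷ p2301 ∷ p0231 ∷ [])
  ∷ (p2013 ∷ p3210 ∷ p0312 ∷ []
    , p2310 ∷ p3012 ∷ p1302 ∷ p3102 ∷ p1032 ∷ p0132 ∷ p2031 ∷ p3201 ∷ p2301 ∷ p0231 ∷ p2130 ∷ p1230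
      ∷ p3120 ∷ p1320 ∷ p3021 ∷ p0321 ∷ p1023 ∷ p0123 ∷ p1203 ∷ p2103 ∷ p0213 ∷ [])
  ∷ (p3021 ∷ p1320 ∷ p0123 ∷ []
    , p3120 ∷ p1023 ∷ p2103 ∷ p1203 ∷ p2013 ∷ p0213 ∷ p3012 ∷ p1302 ∷ p3102 ∷ p0312 ∷ p3210 ∷ p2310
      ∷ p1230 ∷ p2130 ∷ p1032 ∷ p0132 ∷ p2031 ∷ p0231 ∷ p2301 ∷ p3201 ∷ p0321 ∷ [])
  ∷ (p3012 ∷ p2310 ∷ p0213 ∷ []
    , p3210 ∷ p2013 ∷ p1203 ∷ p2103 ∷ p1023 ∷ p0123 ∷ p3021 ∷ p2301 ∷ p3201 ∷ p0321 ∷ p3120 ∷ p1320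
      ∷ p2130 ∷ p1230 ∷ p2031 ∷ p0231 ∷ p1032 ∷ p0132 ∷ p1302 ∷ p3102 ∷ p0312 ∷ [])
  ∷ []

family 4 =
    (p0231 ∷ p2130 ∷ p1320 ∷ p3021 ∷ []
    , p2103 ∷ p1023 ∷ p0123 ∷ p1203 ∷ p2301 ∷ p3201 ∷ p0321 ∷ p2031 ∷ p1230 ∷ p3120 ∷ p2310 ∷ p3210
      ∷ p0312 ∷ p2013 ∷ p0213 ∷ p3012 ∷ p0132 ∷ p1032 ∷ p3102 ∷ p1302 ∷ [])
  ∷ (p0321 ∷ p3120 ∷ p1230 ∷ p2031 ∷ []
    , p3102 ∷ p1032 ∷ p0132 ∷ p1302 ∷ p3201 ∷ p2301 ∷ p0231 ∷ p3021 ∷ p1320 ∷ p2130 ∷ p3210 ∷ p2310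
      ∷ p0213 ∷ p3012 ∷ p0312 ∷ p2013 ∷ p0123 ∷ p1023 ∷ p2103 ∷ p1203 ∷ [])
  ∷ (p2013 ∷ p0312 ∷ p3102 ∷ p1203 ∷ []
    , p0321 ∷ p3201 ∷ p2301 ∷ p3021 ∷ p0123 ∷ p1023 ∷ p2103 ∷ p0213 ∷ p3012 ∷ p1302 ∷ p0132 ∷ p1032
      ∷ p2130 ∷ p0231 ∷ p2031 ∷ p1230 ∷ p2310 ∷ p3210 ∷ p1320 ∷ p3120 ∷ [])
  ∷ (p2103 ∷ p1302 ∷ p3012 ∷ p0213 ∷ []
    , p1320 ∷ p3210 ∷ p2310 ∷ p3120 ∷ p1023 ∷ p0123 ∷ p2013 ∷ p1203 ∷ p3102 ∷ p0312 ∷ p1032 ∷ p0132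
      ∷ p2031 ∷ p1230 ∷ p2130 ∷ p0231 ∷ p2301 ∷ p3201 ∷ p0321 ∷ p3021 ∷ [])
  ∷ (p0132 ∷ p1230 ∷ p2310 ∷ p3012 ∷ []
    , p1203 ∷ p2013 ∷ p0213 ∷ p2103 ∷ p1302 ∷ p3102 ∷ p0312 ∷ p1032 ∷ p2130 ∷ p3210 ∷ p1320 ∷ p3120
      ∷ p0321 ∷ p1023 ∷ p0123 ∷ p3021 ∷ p0231 ∷ p2031 ∷ p3201 ∷ p2301 ∷ [])
  ∷ (p0312 ∷ p3210 ∷ p2130 ∷ p1032 ∷ []
    , p3201 ∷ p2031 ∷ p0231 ∷ p2301 ∷ p3102 ∷ p1302 ∷ p0132 ∷ p3012 ∷ p2310 ∷ p1230 ∷ p3120 ∷ p1320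
      ∷ p0123 ∷ p3021 ∷ p0321 ∷ p1023 ∷ p0213 ∷ p2013 ∷ p1203 ∷ p2103 ∷ [])
  ∷ (p0123 ∷ p1320 ∷ p3210 ∷ p2013 ∷ []
    , p1302 ∷ p3012 ∷ p0312 ∷ p3102 ∷ p1203 ∷ p2103 ∷ p0213 ∷ p1023 ∷ p3120 ∷ p2310 ∷ p1230 ∷ p2130
      ∷ p0231 ∷ p1032 ∷ p0132 ∷ p2031 ∷ p0321 ∷ p3021 ∷ p2301 ∷ p3201 ∷ [])
  ∷ (p0213 ∷ p2310 ∷ p3120 ∷ p1023 ∷ []
    , p2301 ∷ p3021 ∷ p0321 ∷ p3201 ∷ p2103 ∷ p1203 ∷ p0123 ∷ p2013 ∷ p3210 ∷ p1320 ∷ p2130 ∷ p1230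
      ∷ p0132 ∷ p2031 ∷ p0231 ∷ p1032 ∷ p0312 ∷ p3012 ∷ p1302 ∷ p3102 ∷ [])
  ∷ (p1032 ∷ p0231 ∷ p2301 ∷ p3102 ∷ []
    , p0213 ∷ p2103 ∷ p1203 ∷ p2013 ∷ p0312 ∷ p3012 ∷ p1302 ∷ p0132 ∷ p2031 ∷ p3201 ∷ p0321 ∷ p3021
      ∷ p1320 ∷ p0123 ∷ p1023 ∷ p3120 ∷ p1230 ∷ p2130 ∷ p3210 ∷ p2310 ∷ [])
  ∷ (p1302 ∷ p3201 ∷ p2031 ∷ p0132 ∷ []
    , p3210 ∷ p2130 ∷ p1230 ∷ p2310 ∷ p3012 ∷ p0312 ∷ p1032 ∷ p3102 ∷ p2301 ∷ p0231 ∷ p3021 ∷ p0321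
      ∷ p1023 ∷ p3120 ∷ p1320 ∷ p0123 ∷ p1203 ∷ p2103 ∷ p0213 ∷ p2013 ∷ [])
  ∷ []

family 5 =
    (p2301 ∷ p3102 ∷ p1302 ∷ p2103 ∷ p1203 ∷ []
    , p2310 ∷ p1230 ∷ p0132 ∷ p3012 ∷ p0213 ∷ p2013 ∷ p0312 ∷ p3210 ∷ p1320 ∷ p2130 ∷ p1032 ∷ p0231
      ∷ p2031 ∷ p3201 ∷ p0321 ∷ p3021 ∷ p0123 ∷ p1023 ∷ p3120 ∷ [])
  ∷ (p2310 ∷ p3012 ∷ p0312 ∷ p2013 ∷ p0213 ∷ []
    , p2301 ∷ p0231 ∷ p1032 ∷ p3102 ∷ p1203 ∷ p2103 ∷ p1302 ∷ p3201 ∷ p0321 ∷ p2031 ∷ p0132 ∷ p1230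
      ∷ p2130 ∷ p3210 ∷ p1320 ∷ p3120 ∷ p1023 ∷ p0123 ∷ p3021 ∷ [])
  ∷ (p1320 ∷ p3021 ∷ p0321 ∷ p1023 ∷ p0123 ∷ []
    , p1302 ∷ p0132 ∷ p2031 ∷ p3201 ∷ p2103 ∷ p1203 ∷ p2301 ∷ p3102 ∷ p0312 ∷ p1032 ∷ p0231 ∷ p2130
      ∷ p1230 ∷ p3120 ∷ p2310 ∷ p3210 ∷ p2013 ∷ p0213 ∷ p3012 ∷ [])
  ∷ (p0132 ∷ p3012 ∷ p1302 ∷ p3201 ∷ p2031 ∷ []
    , p3021 ∷ p1320 ∷ p0123 ∷ p2013 ∷ p3210 ∷ p0312 ∷ p1032 ∷ p0231 ∷ p2130 ∷ p1230 ∷ p2310 ∷ p3120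
      ∷ p0321 ∷ p1023 ∷ p0213 ∷ p2103 ∷ p1203 ∷ p3102 ∷ p2301 ∷ [])
  ∷ (p1320 ∷ p2130 ∷ p3210 ∷ p2013 ∷ p0123 ∷ []
    , p2103 ∷ p3201 ∷ p1302 ∷ p0132 ∷ p2031 ∷ p1230 ∷ p3120 ∷ p1023 ∷ p0321 ∷ p3021 ∷ p0231 ∷ p2301
      ∷ p1203 ∷ p3102 ∷ p1032 ∷ p0312 ∷ p3012 ∷ p2310 ∷ p0213 ∷ [])
  ∷ (p0231 ∷ p3021 ∷ p2301 ∷ p3102 ∷ p1032 ∷ []
    , p3012 ∷ p2310 ∷ p0213 ∷ p1023 ∷ p3120 ∷ p0321 ∷ p2031 ∷ p0132 ∷ p1230 ∷ p2130 ∷ p1320 ∷ p3210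
      ∷ p0312 ∷ p2013 ∷ p0123 ∷ p1203 ∷ p2103 ∷ p3201 ∷ p1302 ∷ [])
  ∷ (p0312 ∷ p3102 ∷ p1032 ∷ p0132 ∷ p3012 ∷ []
    , p3210 ∷ p2130 ∷ p0231 ∷ p2031 ∷ p3201 ∷ p1302 ∷ p2103 ∷ p1203 ∷ p2301 ∷ p3021 ∷ p0321 ∷ p1023
      ∷ p3120 ∷ p1230 ∷ p2310 ∷ p0213 ∷ p2013 ∷ p0123 ∷ p1320 ∷ [])
  ∷ (p0213 ∷ p2103 ∷ p1023 ∷ p0123 ∷ p2013 ∷ []
    , p2310 ∷ p3120 ∷ p0321 ∷ p3021 ∷ p2301 ∷ p1203 ∷ p3102 ∷ p1302 ∷ p3201 ∷ p2031 ∷ p0231 ∷ p1032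
      ∷ p2130 ∷ p1320 ∷ p3210 ∷ p0312 ∷ p3012 ∷ p0132 ∷ p1230 ∷ [])
  ∷ (p2031 ∷ p0132 ∷ p1032 ∷ p2130 ∷ p1230 ∷ []
    , p2013 ∷ p1203 ∷ p3102 ∷ p0312 ∷ p3210 ∷ p2310 ∷ p3012 ∷ p0213 ∷ p1023 ∷ p2103 ∷ p1302 ∷ p3201
      ∷ p2301 ∷ p0231 ∷ p3021 ∷ p0321 ∷ p3120 ∷ p1320 ∷ p0123 ∷ [])
  ∷ []

family 6 =
    (p0213 ∷ p1023 ∷ p0321 ∷ p3021 ∷ p0123 ∷ p2013 ∷ []
    , p2103 ∷ p3201 ∷ p2301 ∷ p1203 ∷ p3102 ∷ p1032 ∷ p0132 ∷ p2031 ∷ p0231 ∷ p2130 ∷ p1320 ∷ p3120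
      ∷ p1230 ∷ p2310 ∷ p3210 ∷ p0312 ∷ p3012 ∷ p1302 ∷ [])
  ∷ (p0312 ∷ p1032 ∷ p0231 ∷ p2031 ∷ p0132 ∷ p3012 ∷ []
    , p3102 ∷ p2301 ∷ p3201 ∷ p1302 ∷ p2103 ∷ p1023 ∷ p0123 ∷ p3021 ∷ p0321 ∷ p3120 ∷ p1230 ∷ p2130
      ∷ p1320 ∷ p3210 ∷ p2310 ∷ p0213 ∷ p2013 ∷ p1203 ∷ [])
  ∷ (p1203 ∷ p3102 ∷ p1302 ∷ p3012 ∷ p0213 ∷ p2103 ∷ []
    , p1032 ∷ p2130 ∷ p3210 ∷ p2310 ∷ p1230 ∷ p0132 ∷ p2031 ∷ p0231 ∷ p3021 ∷ p2301 ∷ p3201 ∷ p0321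
      ∷ p1023 ∷ p3120 ∷ p1320 ∷ p0123 ∷ p2013 ∷ p0312 ∷ [])
  ∷ (p0123 ∷ p1320 ∷ p2130 ∷ p3210 ∷ p0312 ∷ p2013 ∷ []
    , p1230 ∷ p0132 ∷ p1032 ∷ p0231 ∷ p3021 ∷ p2301 ∷ p3102 ∷ p1203 ∷ p2103 ∷ p1023 ∷ p0213 ∷ p3012
      ∷ p1302 ∷ p3201 ∷ p2031 ∷ p0321 ∷ p3120 ∷ p2310 ∷ [])
  ∷ (p1203 ∷ p2301 ∷ p0231 ∷ p3021 ∷ p1320 ∷ p0123 ∷ []
    , p2031 ∷ p1230 ∷ p2130 ∷ p1032 ∷ p3102 ∷ p0312 ∷ p3210 ∷ p2013 ∷ p0213 ∷ p2103 ∷ p1023 ∷ p3120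
      ∷ p2310 ∷ p3012 ∷ p0132 ∷ p1302 ∷ p3201 ∷ p0321 ∷ [])
  ∷ (p1302 ∷ p3201 ∷ p0321 ∷ p2031 ∷ p1230 ∷ p0132 ∷ []
    , p3021 ∷ p1320 ∷ p3120 ∷ p1023 ∷ p2103 ∷ p0213 ∷ p2310 ∷ p3012 ∷ p0312 ∷ p3102 ∷ p1032 ∷ p2130
      ∷ p3210 ∷ p2013 ∷ p0123 ∷ p1203 ∷ p2301 ∷ p0231 ∷ [])
  ∷ (p1302 ∷ p0132 ∷ p1230 ∷ p2130 ∷ p1032 ∷ p3102 ∷ []
    , p3012 ∷ p2310 ∷ p3210 ∷ p0312 ∷ p2013 ∷ p0123 ∷ p1023 ∷ p3120 ∷ p1320 ∷ p3021 ∷ p0231 ∷ p2031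
      ∷ p0321 ∷ p3201 ∷ p2301 ∷ p1203 ∷ p2103 ∷ p0213 ∷ [])
  ∷ (p1203 ∷ p0123 ∷ p1320 ∷ p3120 ∷ p1023 ∷ p2103 ∷ []
    , p2013 ∷ p3210 ∷ p2310 ∷ p0213 ∷ p3012 ∷ p0132 ∷ p1032 ∷ p2130 ∷ p1230 ∷ p2031 ∷ p0321 ∷ p3021
      ∷ p0231 ∷ p2301 ∷ p3201 ∷ p1302 ∷ p3102 ∷ p0312 ∷ [])
  ∷ []

family 7 =
    (p1203 ∷ p2301 ∷ p0231 ∷ p2130 ∷ p1032 ∷ p0312 ∷ p3102 ∷ []
    , p2310 ∷ p0213 ∷ p3012 ∷ p0132 ∷ p2031 ∷ p3201 ∷ p1302 ∷ p2103 ∷ p1023 ∷ p0123 ∷ p2013 ∷ p3210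
      ∷ p1320 ∷ p3021 ∷ p0321 ∷ p3120 ∷ p1230 ∷ [])
  ∷ (p1230 ∷ p0132 ∷ p1302 ∷ p3012 ∷ p0312 ∷ p3210 ∷ p2310 ∷ []
    , p2013 ∷ p1203 ∷ p0123 ∷ p1023 ∷ p0321 ∷ p3120 ∷ p1320 ∷ p2130 ∷ p1032 ∷ p3102 ∷ p2301 ∷ p3021
      ∷ p0231 ∷ p2031 ∷ p3201 ∷ p2103 ∷ p0213 ∷ [])
  ∷ (p2130 ∷ p0231 ∷ p3021 ∷ p1320 ∷ p0123 ∷ p2013 ∷ p3210 ∷ []
    , p0213 ∷ p3012 ∷ p1302 ∷ p3102 ∷ p0312 ∷ p1032 ∷ p0132 ∷ p2031 ∷ p1230 ∷ p2310 ∷ p3120 ∷ p1023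
      ∷ p0321 ∷ p3201 ∷ p2301 ∷ p1203 ∷ p2103 ∷ [])
  ∷ (p3021 ∷ p0321 ∷ p2031 ∷ p0132 ∷ p1302 ∷ p3201 ∷ p2301 ∷ []
    , p2103 ∷ p1023 ∷ p0213 ∷ p3012 ∷ p0312 ∷ p3102 ∷ p1032 ∷ p0231 ∷ p2130 ∷ p1320 ∷ p3120 ∷ p1230
      ∷ p2310 ∷ p3210 ∷ p2013 ∷ p0123 ∷ p1203 ∷ [])
  ∷ (p2130 ∷ p1320 ∷ p3120 ∷ p1230 ∷ p2031 ∷ p0132 ∷ p1032 ∷ []
    , p2310 ∷ p3210 ∷ p2013 ∷ p0123 ∷ p3021 ∷ p0231 ∷ p2301 ∷ p1203 ∷ p2103 ∷ p0213 ∷ p1023 ∷ p0321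
      ∷ p3201 ∷ p1302 ∷ p3102 ∷ p0312 ∷ p3012 ∷ [])
  ∷ (p0123 ∷ p3021 ∷ p0231 ∷ p2301 ∷ p3201 ∷ p2103 ∷ p1203 ∷ []
    , p1302 ∷ p0132 ∷ p3012 ∷ p0312 ∷ p3210 ∷ p2013 ∷ p0213 ∷ p1023 ∷ p0321 ∷ p2031 ∷ p1230 ∷ p2310
      ∷ p3120 ∷ p1320 ∷ p2130 ∷ p1032 ∷ p3102 ∷ [])
  ∷ (p1023 ∷ p0321 ∷ p2031 ∷ p0132 ∷ p1230 ∷ p2310 ∷ p3120 ∷ []
    , p0312 ∷ p2013 ∷ p3210 ∷ p2130 ∷ p0231 ∷ p3021 ∷ p1320 ∷ p0123 ∷ p1203 ∷ p2103 ∷ p0213 ∷ p3012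
      ∷ p1302 ∷ p3201 ∷ p2301 ∷ p3102 ∷ p1032 ∷ [])
  ∷ []

family 8 =
    (p3102 ∷ p1302 ∷ p2103 ∷ p0213 ∷ p1023 ∷ p0123 ∷ p1203 ∷ p2301 ∷ []
    , p2310 ∷ p3120 ∷ p1230 ∷ p2130 ∷ p1320 ∷ p3210 ∷ p2013 ∷ p0312 ∷ p1032 ∷ p0231 ∷ p3021 ∷ p0321
      ∷ p3201 ∷ p2031 ∷ p0132 ∷ p3012 ∷ [])
  ∷ (p2013 ∷ p0213 ∷ p3012 ∷ p1302 ∷ p0132 ∷ p1032 ∷ p0312 ∷ p3210 ∷ []
    , p3201 ∷ p2031 ∷ p0321 ∷ p3021 ∷ p0231 ∷ p2301 ∷ p3102 ∷ p1203 ∷ p0123 ∷ p1320 ∷ p2130 ∷ p1230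
      ∷ p2310 ∷ p3120 ∷ p1023 ∷ p2103 ∷ [])
  ∷ (p3021 ∷ p0123 ∷ p1203 ∷ p2013 ∷ p3210 ∷ p1320 ∷ p3120 ∷ p0321 ∷ []
    , p3012 ∷ p0213 ∷ p1023 ∷ p2103 ∷ p3201 ∷ p2301 ∷ p0231 ∷ p2031 ∷ p0132 ∷ p1302 ∷ p3102 ∷ p0312
      ∷ p1032 ∷ p2130 ∷ p1230 ∷ p2310 ∷ [])
  ∷ (p1032 ∷ p0231 ∷ p2301 ∷ p3021 ∷ p1320 ∷ p2130 ∷ p1230 ∷ p0132 ∷ []
    , p1023 ∷ p0321 ∷ p2031 ∷ p3201 ∷ p1302 ∷ p3102 ∷ p0312 ∷ p3012 ∷ p0213 ∷ p2103 ∷ p1203 ∷ p0123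
      ∷ p2013 ∷ p3210 ∷ p2310 ∷ p3120 ∷ [])
  ∷ (p0321 ∷ p1023 ∷ p0123 ∷ p2013 ∷ p0312 ∷ p1032 ∷ p0231 ∷ p2031 ∷ []
    , p1320 ∷ p3210 ∷ p2130 ∷ p1230 ∷ p3120 ∷ p2310 ∷ p0213 ∷ p3012 ∷ p0132 ∷ p1302 ∷ p3201 ∷ p2103
      ∷ p1203 ∷ p3102 ∷ p2301 ∷ p3021 ∷ [])
  ∷ (p2310 ∷ p3210 ∷ p2130 ∷ p1320 ∷ p0123 ∷ p1023 ∷ p2103 ∷ p0213 ∷ []
    , p3102 ∷ p1203 ∷ p2013 ∷ p0312 ∷ p3012 ∷ p1302 ∷ p0132 ∷ p1230 ∷ p3120 ∷ p0321 ∷ p3021 ∷ p2301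
      ∷ p3201 ∷ p2031 ∷ p0231 ∷ p1032 ∷ [])
  ∷ []

family 9 =
    (p2031 ∷ p0321 ∷ p3120 ∷ p1320 ∷ p0123 ∷ p1203 ∷ p2301 ∷ p3021 ∷ p0231 ∷ []
    , p1302 ∷ p3012 ∷ p2310 ∷ p3210 ∷ p2130 ∷ p1230 ∷ p0132 ∷ p1032 ∷ p3102 ∷ p0312 ∷ p2013 ∷ p0213
      ∷ p1023 ∷ p2103 ∷ p3201 ∷ [])
  ∷ (p0123 ∷ p1203 ∷ p2301 ∷ p3201 ∷ p1302 ∷ p3012 ∷ p0213 ∷ p2103 ∷ p1023 ∷ []
    , p3210 ∷ p2130 ∷ p0231 ∷ p2031 ∷ p0321 ∷ p3021 ∷ p1320 ∷ p3120 ∷ p2310 ∷ p1230 ∷ p0132 ∷ p1032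
      ∷ p3102 ∷ p0312 ∷ p2013 ∷ [])
  ∷ (p3201 ∷ p0321 ∷ p1023 ∷ p0123 ∷ p2013 ∷ p3210 ∷ p2130 ∷ p1230 ∷ p2031 ∷ []
    , p1203 ∷ p2301 ∷ p3102 ∷ p1302 ∷ p0132 ∷ p3012 ∷ p0312 ∷ p1032 ∷ p0231 ∷ p3021 ∷ p1320 ∷ p3120
      ∷ p2310 ∷ p0213 ∷ p2103 ∷ [])
  ∷ (p2031 ∷ p3201 ∷ p1302 ∷ p3012 ∷ p0132 ∷ p1230 ∷ p2130 ∷ p1032 ∷ p0231 ∷ []
    , p2301 ∷ p3102 ∷ p1203 ∷ p2013 ∷ p0312 ∷ p3210 ∷ p2310 ∷ p0213 ∷ p2103 ∷ p1023 ∷ p0123 ∷ p1320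
      ∷ p3120 ∷ p0321 ∷ p3021 ∷ [])
  ∷ (p1302 ∷ p0132 ∷ p1230 ∷ p3120 ∷ p1023 ∷ p2103 ∷ p3201 ∷ p2301 ∷ p3102 ∷ []
    , p0231 ∷ p2130 ∷ p1032 ∷ p0312 ∷ p3210 ∷ p2310 ∷ p3012 ∷ p0213 ∷ p2013 ∷ p1203 ∷ p0123 ∷ p1320
      ∷ p3021 ∷ p0321 ∷ p2031 ∷ [])
  ∷ (p3120 ∷ p1230 ∷ p2031 ∷ p0231 ∷ p1032 ∷ p0312 ∷ p3210 ∷ p2130 ∷ p1320 ∷ []
    , p0213 ∷ p2103 ∷ p3201 ∷ p2301 ∷ p3021 ∷ p0321 ∷ p1023 ∷ p0123 ∷ p2013 ∷ p1203 ∷ p3102 ∷ p1302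
      ∷ p0132 ∷ p3012 ∷ p2310 ∷ [])
  ∷ []

family 10 =
    (p3021 ∷ p0321 ∷ p1023 ∷ p3120 ∷ p1320 ∷ p0123 ∷ p2013 ∷ p3210 ∷ p2130 ∷ p0231 ∷ []
    , p2301 ∷ p3201 ∷ p2103 ∷ p0213 ∷ p2310 ∷ p1230 ∷ p2031 ∷ p0132 ∷ p1302 ∷ p3012 ∷ p0312 ∷ p1032
      ∷ p3102 ∷ p1203 ∷ [])
  ∷ (p2031 ∷ p0231 ∷ p1032 ∷ p2130 ∷ p1230 ∷ p0132 ∷ p3012 ∷ p2310 ∷ p3120 ∷ p0321 ∷ []
    , p3201 ∷ p2301 ∷ p3102 ∷ p0312 ∷ p3210 ∷ p1320 ∷ p3021 ∷ p0123 ∷ p1203 ∷ p2013 ∷ p0213 ∷ p1023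
      ∷ p2103 ∷ p1302 ∷ [])
  ∷ (p3210 ∷ p2310 ∷ p0213 ∷ p3012 ∷ p0312 ∷ p2013 ∷ p1203 ∷ p3102 ∷ p1032 ∷ p2130 ∷ []
    , p1320 ∷ p3120 ∷ p1023 ∷ p2103 ∷ p1302 ∷ p0132 ∷ p1230 ∷ p2031 ∷ p0321 ∷ p3201 ∷ p2301 ∷ p0231
      ∷ p3021 ∷ p0123 ∷ [])
  ∷ (p1302 ∷ p3201 ∷ p2031 ∷ p0321 ∷ p3021 ∷ p0123 ∷ p1203 ∷ p2013 ∷ p0312 ∷ p3012 ∷ []
    , p2103 ∷ p0213 ∷ p2310 ∷ p1230 ∷ p0132 ∷ p1032 ∷ p3102 ∷ p2301 ∷ p0231 ∷ p2130 ∷ p3210 ∷ p1320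
      ∷ p3120 ∷ p1023 ∷ [])
  ∷ (p2310 ∷ p3012 ∷ p0132 ∷ p1302 ∷ p3102 ∷ p1203 ∷ p2013 ∷ p0123 ∷ p1320 ∷ p3120 ∷ []
    , p0213 ∷ p1023 ∷ p0321 ∷ p2031 ∷ p1230 ∷ p2130 ∷ p3210 ∷ p0312 ∷ p1032 ∷ p0231 ∷ p3021 ∷ p2301
      ∷ p3201 ∷ p2103 ∷ [])
  ∷ (p3120 ∷ p1320 ∷ p0123 ∷ p3021 ∷ p0321 ∷ p1023 ∷ p2103 ∷ p3201 ∷ p2031 ∷ p1230 ∷ []
    , p2310 ∷ p3210 ∷ p2013 ∷ p1203 ∷ p2301 ∷ p0231 ∷ p2130 ∷ p1032 ∷ p0312 ∷ p3102 ∷ p1302 ∷ p0132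
      ∷ p3012 ∷ p0213 ∷ [])
  ∷ []

family 11 =
    (p2013 ∷ p1203 ∷ p2103 ∷ p1023 ∷ p0213 ∷ p2310 ∷ p3120 ∷ p0321 ∷ p3021 ∷ p1320 ∷ p0123 ∷ []
    , p2301 ∷ p0231 ∷ p2031 ∷ p1230 ∷ p2130 ∷ p3210 ∷ p0312 ∷ p3102 ∷ p1032 ∷ p0132 ∷ p3012 ∷ p1302
      ∷ p3201 ∷ [])
  ∷ (p1230 ∷ p3120 ∷ p1320 ∷ p3210 ∷ p2130 ∷ p1032 ∷ p0312 ∷ p2013 ∷ p0213 ∷ p3012 ∷ p2310 ∷ []
    , p1023 ∷ p2103 ∷ p1203 ∷ p3102 ∷ p1302 ∷ p0132 ∷ p2031 ∷ p0321 ∷ p3201 ∷ p2301 ∷ p0231 ∷ p3021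
      ∷ p0123 ∷ [])
  ∷ (p0123 ∷ p3021 ∷ p0231 ∷ p2130 ∷ p1032 ∷ p0132 ∷ p2031 ∷ p1230 ∷ p2310 ∷ p0213 ∷ p1023 ∷ []
    , p3210 ∷ p1320 ∷ p3120 ∷ p0321 ∷ p3201 ∷ p2103 ∷ p1203 ∷ p2301 ∷ p3102 ∷ p1302 ∷ p3012 ∷ p0312
      ∷ p2013 ∷ [])
  ∷ (p0213 ∷ p2013 ∷ p3210 ∷ p2130 ∷ p0231 ∷ p1032 ∷ p0132 ∷ p1302 ∷ p3201 ∷ p2103 ∷ p1023 ∷ []
    , p0321 ∷ p3021 ∷ p1320 ∷ p0123 ∷ p1203 ∷ p2301 ∷ p3102 ∷ p0312 ∷ p3012 ∷ p2310 ∷ p3120 ∷ p1230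
      ∷ p2031 ∷ [])
  ∷ (p2013 ∷ p3210 ∷ p2310 ∷ p3120 ∷ p0321 ∷ p3201 ∷ p2301 ∷ p3021 ∷ p0231 ∷ p1032 ∷ p0312 ∷ []
    , p1203 ∷ p2103 ∷ p0213 ∷ p1023 ∷ p0123 ∷ p1320 ∷ p2130 ∷ p1230 ∷ p2031 ∷ p0132 ∷ p3012 ∷ p1302
      ∷ p3102 ∷ [])
  ∷ []

family 12 =
    (p2310 ∷ p3120 ∷ p1230 ∷ p2031 ∷ p0321 ∷ p3021 ∷ p1320 ∷ p3210 ∷ p2013 ∷ p0123 ∷ p1023 ∷ p0213 ∷ []
    , p0132 ∷ p3012 ∷ p0312 ∷ p1032 ∷ p2130 ∷ p0231 ∷ p2301 ∷ p3201 ∷ p2103 ∷ p1203 ∷ p3102 ∷ p1302 ∷ [])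
  ∷ (p3210 ∷ p2130 ∷ p1320 ∷ p3021 ∷ p0231 ∷ p2031 ∷ p1230 ∷ p2310 ∷ p3012 ∷ p0132 ∷ p1032 ∷ p0312 ∷ []
    , p0123 ∷ p2013 ∷ p0213 ∷ p1023 ∷ p3120 ∷ p0321 ∷ p3201 ∷ p2301 ∷ p3102 ∷ p1302 ∷ p2103 ∷ p1203 ∷ [])
  ∷ (p3021 ∷ p0123 ∷ p2013 ∷ p3210 ∷ p2310 ∷ p0213 ∷ p3012 ∷ p0312 ∷ p3102 ∷ p1203 ∷ p2301 ∷ p0231 ∷ []
    , p0321 ∷ p3120 ∷ p1320 ∷ p2130 ∷ p1032 ∷ p0132 ∷ p1230 ∷ p2031 ∷ p3201 ∷ p1302 ∷ p2103 ∷ p1023 ∷ [])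
  ∷ (p1230 ∷ p2310 ∷ p3210 ∷ p2013 ∷ p0312 ∷ p3102 ∷ p1302 ∷ p0132 ∷ p3012 ∷ p0213 ∷ p1023 ∷ p3120 ∷ []
    , p0321 ∷ p2031 ∷ p3201 ∷ p2103 ∷ p1203 ∷ p2301 ∷ p0231 ∷ p1032 ∷ p2130 ∷ p1320 ∷ p0123 ∷ p3021 ∷ [])
  ∷ (p2301 ∷ p0231 ∷ p1032 ∷ p0132 ∷ p3012 ∷ p2310 ∷ p0213 ∷ p2103 ∷ p1023 ∷ p0123 ∷ p1320 ∷ p3021 ∷ []
    , p1230 ∷ p3120 ∷ p0321 ∷ p2031 ∷ p3201 ∷ p1302 ∷ p3102 ∷ p1203 ∷ p2013 ∷ p0312 ∷ p3210 ∷ p2130 ∷ [])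
  ∷ []

family _ = []

certified : All (λ ℓ → Certificate ℓ (24 ∸ ℓ) (family ℓ)) (applyUpTo (3 +_) 10)
certified = from-yes (All.all? (λ ℓ → certificate? ℓ (24 ∸ ℓ) (family ℓ)) (applyUpTo (3 +_) 10))

lemma3p1 : (u v : Word 4) → IsPerm u → IsPerm v → u ≢ v →
    (ℓ : ℕ) → 3 ≤ ℓ → ℓ ≤ 12 →
    Σ (List (Word 4)) λ C₁ → Σ (List (Word 4)) λ C₂ →
      IsCycle {2} C₁ × IsCycle {2} C₂ × Disjoint C₁ C₂
      × u ∈ C₁ × v ∈ C₂
      × ((length C₁ ≡ ℓ × length C₂ ≡ 24 ∸ ℓ)
         ⊎ (length C₁ ≡ 24 ∸ ℓ × length C₂ ≡ ℓ))
lemma3p1 u v pu pv u≢v ℓ 3≤ℓ ℓ≤12 =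
  certificate⇒separatingCycles (All.lookup certified (∈-applyUpTo-+ 3≤ℓ (s≤s ℓ≤12))) pu pv u≢v
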